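{- Let $A$ and $B$ be alternating sign hypermatrices of order $n$. Then $A\preceq_B B$ if and only if $\Xi(A)\ge\Xi(B)$ entrywise.
   Context: An alternating sign hypermatrix (ASHM) of order $n$ is an $n\times n\times n$ array with entries in $\{0,1,-1\}$ such that in each line (fixing two of the three indices) the nonzero entries alternate in sign, starting and ending with $+1$. $\Xi(A)_{i,j,k}=\sum_{a=1}^i\sum_{b=1}^j\sum_{c=1}^k A_{a,b,c}$ for $i,j,k\in[0,n]$. A positive T-block is an $n\times n\times n$ hypermatrix $T$ for which there exist $i_1<i_2$, $j_1<j_2$, $k_1<k_2$ in $[n]$ such that $T$ is zero outside $\{i_1,i_2\}\times\{j_1,j_2\}\times\{k_1,k_2\}$, $T_{i_1,j_1,k_1}=T_{i_2,j_2,k_1}=1$, $T_{i_1,j_2,k_1}=T_{i_2,j_1,k_1}=-1$, and $T_{i,j,k_2}=-T_{i,j,k_1}$. $A\preceq_B B$ iff $A-B$ is a sum of finitely many positive T-blocks. -}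

module Defs where

open import Data.Nat using (ℕ; zero; suc)
open import Data.Fin using (Fin; toℕ) renaming (_<_ to _<ᶠ_)
open import Data.Integer using (ℤ; +_; -_; _+_; _-_; _≤_; 0ℤ; 1ℤ; -1ℤ)
open import Data.List using (List; []; _∷_; foldr; map; filterᵇ)
open import Data.List.Relation.Unary.All using (All)
open import Data.Vec.Functional using (toList)
open import Data.Product using (Σ; ∃; _×_; _,_)
open import Data.Sum using (_⊎_)
open import Data.Bool using (Bool; true; false; if_then_else_)
open import Relation.Nullary.Decidable using (⌊_⌋)
open import Relation.Binary.PropositionalEquality using (_≡_)
open import Relation.Nullary using (¬_)

-- An n × n × n hypermatrix with integer entries, indices in [n] = Fin n
-- (Fin n index t corresponds to the paper's index t+1).
Hyper : ℕ → Set
Hyper n = Fin n → Fin n → Fin n → ℤ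

Trit : ℤ → Set
Trit x = (x ≡ 0ℤ) ⊎ (x ≡ 1ℤ) ⊎ (x ≡ -1ℤ)

isNonzero : ℤ → Bool
isNonzero (+ zero) = false
isNonzero _ = true

data AltSeq : List ℤ → Set where
  single : AltSeq (1ℤ ∷ [])
  step   : ∀ {xs} → AltSeq xs → AltSeq (1ℤ ∷ -1ℤ ∷ xs)

AltLine : List ℤ → Set
AltLine xs = AltSeq (filterᵇ isNonzero xs)

record IsASHM {n : ℕ} (A : Hyper n) : Set where
  field
    entries : ∀ i j k → Trit (A i j k)
    line₁   : ∀ j k → AltLine (toList (λ i → A i j k))
    line₂   : ∀ i k → AltLine (toList (λ j → A i j k))
    line₃   : ∀ i j → AltLine (toList (λ k → A i j k))

-- sum over a : Fin n with toℕ a < m, i.e. paper indices 1..m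
sumUpTo : ∀ {n} → ℕ → (Fin n → ℤ) → ℤ
sumUpTo {n} m f = foldr _+_ 0ℤ (toList (λ a → if ⌊ toℕ a Data.Nat.<? m ⌋ then f a else 0ℤ))
  where import Data.Nat

-- Ξ(A)_{i,j,k} for i,j,k ∈ [0,n], represented by Fin (suc n)
Ξ : ∀ {n} → Hyper n → Fin (suc n) → Fin (suc n) → Fin (suc n) → ℤ
Ξ A i j k = sumUpTo (toℕ i) λ a → sumUpTo (toℕ j) λ b → sumUpTo (toℕ k) λ c → A a b c

record IsPosTBlock {n : ℕ} (T : Hyper n) : Set where
  field
    i₁ i₂ j₁ j₂ k₁ k₂ : Fin n
    i₁<i₂ : i₁ <ᶠ i₂
    j₁<j₂ : j₁ <ᶠ j₂
    k₁<k₂ : k₁ <ᶠ k₂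
    zeroOutside : ∀ i j k → ¬ ((i ≡ i₁ ⊎ i ≡ i₂) × (j ≡ j₁ ⊎ j ≡ j₂) × (k ≡ k₁ ⊎ k ≡ k₂))
                  → T i j k ≡ 0ℤ
    e₁ : T i₁ j₁ k₁ ≡ 1ℤ
    e₂ : T i₂ j₂ k₁ ≡ 1ℤ
    e₃ : T i₁ j₂ k₁ ≡ -1ℤ
    e₄ : T i₂ j₁ k₁ ≡ -1ℤ
    flip : ∀ i j → T i j k₂ ≡ - T i j k₁

zeroH : ∀ {n} → Hyper n
zeroH _ _ _ = 0ℤ

_⊕_ : ∀ {n} → Hyper n → Hyper n → Hyper n
(A ⊕ B) i j k = A i j k + B i j k

sumH : ∀ {n} → List (Hyper n) → Hyper n
sumH = foldr _⊕_ zeroH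

_⪯B_ : ∀ {n} → Hyper n → Hyper n → Set
_⪯B_ {n} A B = Σ (List (Hyper n)) λ Ts →
  All IsPosTBlock Ts × (∀ i j k → A i j k - B i j k ≡ sumH Ts i j k)

_Ξ≥_ : ∀ {n} → Hyper n → Hyper n → Set
A Ξ≥ B = ∀ i j k → Ξ B i j k ≤ Ξ A i j k

{-# OPTIONS --safe #-}

-- Both directions rest on writing a positive T-block at i₁ < i₂, j₁ < j₂, k₁ < k₂ as the
-- tensor product d i₁ i₂ ⊗ d j₁ j₂ ⊗ d k₁ k₂ of the dipoles d p q = e_p − e_q.
--
-- (⇒) Ξ is linear, and Ξ of such a tensor is the product of the prefix sums of its three
-- dipoles, each of which is 0 or 1; so Ξ(A − B) ≥ 0 when A − B is a sum of T-blocks.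
--
-- (⇐) Lines of an ASHM sum to 1, so every line of D = A − B sums to 0.  On vectors with
-- total sum 0, summation by parts inverts prefix sums:
--   G = ∑_{a=1}^{n−1} (G_1 + ⋯ + G_a) (e_a − e_{a+1}).
-- Applied in each of the three coordinates it gives
--   D = ∑_{a,b,c=1}^{n−1} Ξ(D)_{a,b,c} · d a (a+1) ⊗ d b (b+1) ⊗ d c (c+1),
-- a combination of positive T-blocks whose coefficients are nonnegative by hypothesis.
module Submission where

open import Defs
open import Data.Bool using (true; false; if_then_else_)
open import Data.Empty using (⊥-elim)
open import Data.Fin as Fin using (Fin; zero; suc; toℕ; inject₁; fromℕ; _≟_)
import Data.Fin.Properties as Fin
open import Data.Integer as ℤ using (ℤ; +_; -_; _+_; _-_; _*_; _≤_; 0ℤ; 1ℤ; -1ℤ; ∣_∣; +≤+)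
import Data.Integer.Properties as ℤ
open import Algebra.Properties.Semiring.Sum ℤ.+-*-semiring
  using (sum; sum-syntax; sum-cong-≗; sum-replicate-zero; sum-init-last; ∑-distrib-+; ∑-comm;
         *-distribˡ-sum; *-distribʳ-sum)
open import Data.Integer.Tactic.RingSolver using (solve-∀)
open import Data.List using (List; []; _∷_; _++_; foldr; filterᵇ; replicate)
open import Data.List.Relation.Unary.All using (All; []; _∷_)
import Data.List.Relation.Unary.All.Properties as All
open import Data.Nat as ℕ using (ℕ; zero; suc; z≤n; _<?_)
import Data.Nat.Properties as ℕ
open import Data.Product using (Σ; _×_; _,_)
open import Data.Sum using (_⊎_; inj₁; inj₂)
open import Data.Vec.Functional using (toList)
open import Function using (_∘_; _⇔_; mk⇔; Equivalence)
open import Relation.Binary.PropositionalEquality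
open import Relation.Nullary using (¬_; yes; no; does; contradiction)
open import Relation.Nullary.Decidable using (⌊_⌋; isYes≗does; dec-true; dec-false; _⊎-dec_)

private
  variable
    l n m : ℕ

sum-toList : (f : Fin n → ℤ) → foldr _+_ 0ℤ (toList f) ≡ sum f
sum-toList {zero} f = refl
sum-toList {suc n} f = cong (_+_ (f zero)) (sum-toList (f ∘ suc))

∑-neg : (f : Fin n → ℤ) → ∑[ a < n ] (- f a) ≡ - sum f
∑-neg f = begin
  ∑[ a < _ ] (- f a)      ≡⟨ sum-cong-≗ (λ a → ℤ.-1*i≡-i (f a)) ⟨
  ∑[ a < _ ] (-1ℤ * f a)  ≡⟨ *-distribˡ-sum -1ℤ f ⟨
  -1ℤ * sum f            ≡⟨ ℤ.-1*i≡-i (sum f) ⟩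
  - sum f                ∎
  where open ≡-Reasoning

∑-distrib-- : (f g : Fin n → ℤ) → ∑[ a < n ] (f a - g a) ≡ sum f - sum g
∑-distrib-- f g = trans (∑-distrib-+ f (λ a → - g a)) (cong (_+_ (sum f)) (∑-neg g))

-- Kronecker deltas, prefix sums and box sums

δ : Fin n → Fin n → ℤ
δ p x = if does (p ≟ x) then 1ℤ else 0ℤ

δ-diag : (p : Fin n) → δ p p ≡ 1ℤ
δ-diag p = cong (if_then 1ℤ else 0ℤ) (dec-true (p ≟ p) refl)

δ-≢ : {p x : Fin n} → p ≢ x → δ p x ≡ 0ℤ
δ-≢ {p = p} {x} p≢x = cong (if_then 1ℤ else 0ℤ) (dec-false (p ≟ x) p≢x)

δ-sym : (p x : Fin n) → δ p x ≡ δ x p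
δ-sym p x with p ≟ x
... | yes refl = sym (δ-diag p)
... | no p≢x = sym (δ-≢ (p≢x ∘ sym))

∑-δ : (f : Fin n → ℤ) (x : Fin n) → ∑[ a < n ] (f a * δ a x) ≡ f x
∑-δ {suc n} f zero = begin
  f zero * 1ℤ + ∑[ a < n ] (f (suc a) * 0ℤ)
    ≡⟨ cong₂ _+_ (ℤ.*-identityʳ (f zero)) (sum-cong-≗ (ℤ.*-zeroʳ ∘ f ∘ suc)) ⟩
  f zero + ∑[ a < n ] 0ℤ
    ≡⟨ cong (_+_ (f zero)) (sum-replicate-zero n) ⟩
  f zero + 0ℤ
    ≡⟨ ℤ.+-identityʳ (f zero) ⟩
  f zero
    ∎
  where open ≡-Reasoning
∑-δ {suc n} f (suc x) = begin
  f zero * 0ℤ + ∑[ a < n ] (f (suc a) * δ a x)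
    ≡⟨ cong (_+ ∑[ a < n ] (f (suc a) * δ a x)) (ℤ.*-zeroʳ (f zero)) ⟩
  0ℤ + ∑[ a < n ] (f (suc a) * δ a x)
    ≡⟨ ℤ.+-identityˡ _ ⟩
  ∑[ a < n ] (f (suc a) * δ a x)
    ≡⟨ ∑-δ (f ∘ suc) x ⟩
  f (suc x)
    ∎
  where open ≡-Reasoning

restrict : ℕ → (Fin n → ℤ) → Fin n → ℤ
restrict m f a = if ⌊ toℕ a <? m ⌋ then f a else 0ℤ

module _ (f : Fin n → ℤ) (a : Fin n) where

  restrict-inside : toℕ a ℕ.< m → restrict m f a ≡ f a
  restrict-inside {m} a<m = cong (if_then f a else 0ℤ) (trans (isYes≗does _) (dec-true (toℕ a <? m) a<m))

  restrict-outside : ¬ toℕ a ℕ.< m → restrict m f a ≡ 0ℤ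
  restrict-outside {m} a≮m = cong (if_then f a else 0ℤ) (trans (isYes≗does _) (dec-false (toℕ a <? m) a≮m))

  restrict-suc : toℕ a ≢ m → restrict (suc m) f a ≡ restrict m f a
  restrict-suc {m} a≢m with toℕ a <? m
  ... | yes a<m = restrict-inside (ℕ.m<n⇒m<1+n a<m)
  ... | no a≮m = restrict-outside (λ a<1+m → a≮m (ℕ.≤∧≢⇒< (ℕ.s≤s⁻¹ a<1+m) a≢m))

module _ (m : ℕ) (a : Fin n) where

  restrict-cong : {f g : Fin n → ℤ} → (∀ b → f b ≡ g b) → restrict m f a ≡ restrict m g a
  restrict-cong f≗g = cong (if ⌊ toℕ a <? m ⌋ then_else 0ℤ) (f≗g a)

  restrict-+ : (f g : Fin n → ℤ) → restrict m (λ b → f b + g b) a ≡ restrict m f a + restrict m g a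
  restrict-+ f g with ⌊ toℕ a <? m ⌋
  ... | true = refl
  ... | false = refl

  restrict-- : (f g : Fin n → ℤ) → restrict m (λ b → f b - g b) a ≡ restrict m f a - restrict m g a
  restrict-- f g with ⌊ toℕ a <? m ⌋
  ... | true = refl
  ... | false = refl

  restrict-*ˡ : (k : ℤ) (f : Fin n → ℤ) → restrict m (λ b → k * f b) a ≡ k * restrict m f a
  restrict-*ˡ k f with ⌊ toℕ a <? m ⌋
  ... | true = refl
  ... | false = sym (ℤ.*-zeroʳ k)

  restrict-zero : restrict m (λ _ → 0ℤ) a ≡ 0ℤ
  restrict-zero with ⌊ toℕ a <? m ⌋
  ... | true = refl
  ... | false = refl

restrict-∑ : (m : ℕ) (F : Fin n → Fin l → ℤ) (b : Fin l) →
             restrict m (λ b → ∑[ a < n ] F a b) b ≡ ∑[ a < n ] restrict m (F a) b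
restrict-∑ {n} m F b with ⌊ toℕ b <? m ⌋
... | true = refl
... | false = sym (sum-replicate-zero n)

-- Opaque so that unification treats prefixSum m f as rigid instead of unfolding it to a fold.
opaque
  prefixSum : ℕ → (Fin n → ℤ) → ℤ
  prefixSum {n} m f = ∑[ a < n ] restrict m f a

opaque
  unfolding prefixSum

  sumUpTo≡prefixSum : (m : ℕ) (f : Fin n → ℤ) → sumUpTo m f ≡ prefixSum m f
  sumUpTo≡prefixSum m f = sum-toList (restrict m f)

  prefixSum-cong : (m : ℕ) {f g : Fin n → ℤ} → (∀ a → f a ≡ g a) → prefixSum m f ≡ prefixSum m g
  prefixSum-cong m f≗g = sum-cong-≗ (λ a → restrict-cong m a f≗g)

  prefixSum-+ : (m : ℕ) (f g : Fin n → ℤ) → prefixSum m (λ a → f a + g a) ≡ prefixSum m f + prefixSum m g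
  prefixSum-+ m f g = trans (sum-cong-≗ (λ a → restrict-+ m a f g)) (∑-distrib-+ (restrict m f) (restrict m g))

  prefixSum-- : (m : ℕ) (f g : Fin n → ℤ) → prefixSum m (λ a → f a - g a) ≡ prefixSum m f - prefixSum m g
  prefixSum-- m f g = trans (sum-cong-≗ (λ a → restrict-- m a f g)) (∑-distrib-- (restrict m f) (restrict m g))

  prefixSum-*ˡ : (m : ℕ) (k : ℤ) (f : Fin n → ℤ) → prefixSum m (λ a → k * f a) ≡ k * prefixSum m f
  prefixSum-*ˡ m k f = trans (sum-cong-≗ (λ a → restrict-*ˡ m a k f)) (sym (*-distribˡ-sum k (restrict m f)))

  prefixSum-*ʳ : (m : ℕ) (f : Fin n → ℤ) (k : ℤ) → prefixSum m (λ a → f a * k) ≡ prefixSum m f * k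
  prefixSum-*ʳ m f k = begin
    prefixSum m (λ a → f a * k)  ≡⟨ prefixSum-cong m (λ a → ℤ.*-comm (f a) k) ⟩
    prefixSum m (λ a → k * f a)  ≡⟨ prefixSum-*ˡ m k f ⟩
    k * prefixSum m f            ≡⟨ ℤ.*-comm k _ ⟩
    prefixSum m f * k            ∎
    where open ≡-Reasoning

  prefixSum-zero : (m : ℕ) → prefixSum {n} m (λ _ → 0ℤ) ≡ 0ℤ
  prefixSum-zero {n} m = trans (sum-cong-≗ (λ (a : Fin n) → restrict-zero m a)) (sum-replicate-zero n)

  ∑-prefixSum : (m : ℕ) (F : Fin n → Fin l → ℤ) →
                ∑[ a < n ] prefixSum m (F a) ≡ prefixSum m (λ b → ∑[ a < n ] F a b)
  ∑-prefixSum m F =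
    trans (∑-comm (λ a b → restrict m (F a) b)) (sum-cong-≗ (λ b → sym (restrict-∑ m F b)))

  prefixSum-0 : (f : Fin n → ℤ) → prefixSum 0 f ≡ 0ℤ
  prefixSum-0 {n} f = sum-replicate-zero n

  prefixSum-full : (f : Fin n → ℤ) → prefixSum n f ≡ sum f
  prefixSum-full f = sum-cong-≗ (λ a → restrict-inside f a (Fin.toℕ<n a))

  prefixSum-suc : (x : Fin n) (f : Fin n → ℤ) → prefixSum (suc (toℕ x)) f ≡ prefixSum (toℕ x) f + f x
  prefixSum-suc {n} x f = begin
    prefixSum (suc (toℕ x)) f                                ≡⟨ sum-cong-≗ restrict-step ⟩
    ∑[ a < n ] (restrict (toℕ x) f a + f a * δ a x)          ≡⟨ ∑-distrib-+ (restrict (toℕ x) f) _ ⟩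
    prefixSum (toℕ x) f + ∑[ a < n ] (f a * δ a x)           ≡⟨ cong (_+_ (prefixSum (toℕ x) f)) (∑-δ f x) ⟩
    prefixSum (toℕ x) f + f x                                ∎
    where
    open ≡-Reasoning
    restrict-step : (a : Fin n) → restrict (suc (toℕ x)) f a ≡ restrict (toℕ x) f a + f a * δ a x
    restrict-step a with a ≟ x
    ... | yes refl = begin
      restrict (suc (toℕ a)) f a      ≡⟨ restrict-inside f a (ℕ.n<1+n (toℕ a)) ⟩
      f a                             ≡⟨ ℤ.*-identityʳ (f a) ⟨
      f a * 1ℤ                        ≡⟨ ℤ.+-identityˡ _ ⟨
      0ℤ + f a * 1ℤ                   ≡⟨ cong (_+ f a * 1ℤ) (restrict-outside f a (ℕ.n≮n (toℕ a))) ⟨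
      restrict (toℕ a) f a + f a * 1ℤ ∎
    ... | no a≢x = begin
      restrict (suc (toℕ x)) f a      ≡⟨ restrict-suc f a (a≢x ∘ Fin.toℕ-injective) ⟩
      restrict (toℕ x) f a            ≡⟨ ℤ.+-identityʳ _ ⟨
      restrict (toℕ x) f a + 0ℤ       ≡⟨ cong (_+_ (restrict (toℕ x) f a)) (ℤ.*-zeroʳ (f a)) ⟨
      restrict (toℕ x) f a + f a * 0ℤ ∎

  prefixSum-δ : (m : ℕ) (p : Fin n) → prefixSum m (δ p) ≡ restrict m (λ _ → 1ℤ) p
  prefixSum-δ {n} m p = trans (sum-cong-≗ restrict-δ) (∑-δ (restrict m (λ _ → 1ℤ)) p)
    where
    restrict-δ : (a : Fin n) → restrict m (δ p) a ≡ restrict m (λ _ → 1ℤ) a * δ a p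
    restrict-δ a with ⌊ toℕ a <? m ⌋
    ... | true = trans (δ-sym p a) (sym (ℤ.*-identityˡ (δ a p)))
    ... | false = refl

∑-prefixSum-zero : (m : ℕ) (F : Fin n → Fin l → ℤ) → (∀ b → ∑[ a < n ] F a b ≡ 0ℤ) →
                   ∑[ a < n ] prefixSum m (F a) ≡ 0ℤ
∑-prefixSum-zero m F F-lines = trans (∑-prefixSum m F) (trans (prefixSum-cong m F-lines) (prefixSum-zero m))

boxSum : Hyper n → ℕ → ℕ → ℕ → ℤ
boxSum A p q r = prefixSum p λ a → prefixSum q λ b → prefixSum r λ c → A a b c

Ξ≡boxSum : (A : Hyper n) (i j k : Fin (suc n)) → Ξ A i j k ≡ boxSum A (toℕ i) (toℕ j) (toℕ k)
Ξ≡boxSum A i j k =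
  trans (sumUpTo≡prefixSum _ _) (prefixSum-cong _ λ a →
  trans (sumUpTo≡prefixSum _ _) (prefixSum-cong _ λ b →
  sumUpTo≡prefixSum _ (A a b)))

boxSum-cong : {A B : Hyper n} → (∀ a b c → A a b c ≡ B a b c) → (p q r : ℕ) →
              boxSum A p q r ≡ boxSum B p q r
boxSum-cong A≗B p q r = prefixSum-cong p λ a → prefixSum-cong q λ b → prefixSum-cong r λ c → A≗B a b c

boxSum-zeroH : (p q r : ℕ) → boxSum (zeroH {n}) p q r ≡ 0ℤ
boxSum-zeroH p q r =
  trans (prefixSum-cong p λ a → trans (prefixSum-cong q λ b → prefixSum-zero r) (prefixSum-zero q))
        (prefixSum-zero p)

module _ (_∙_ : ℤ → ℤ → ℤ)
         (prefixSum-∙ : ∀ {n} m (f g : Fin n → ℤ) →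
                        prefixSum m (λ a → f a ∙ g a) ≡ prefixSum m f ∙ prefixSum m g)
         where

  boxSum-∙ : (A B : Hyper n) (p q r : ℕ) →
             boxSum (λ a b c → A a b c ∙ B a b c) p q r ≡ boxSum A p q r ∙ boxSum B p q r
  boxSum-∙ A B p q r = trans
    (prefixSum-cong p λ a → trans (prefixSum-cong q λ b → prefixSum-∙ r (A a b) (B a b)) (prefixSum-∙ q _ _))
    (prefixSum-∙ p _ _)

boxSum-⊕ : (A B : Hyper n) (p q r : ℕ) → boxSum (A ⊕ B) p q r ≡ boxSum A p q r + boxSum B p q r
boxSum-⊕ = boxSum-∙ _+_ prefixSum-+

_⊖_ : Hyper n → Hyper n → Hyper n
(A ⊖ B) a b c = A a b c - B a b c

boxSum-⊖ : (A B : Hyper n) (p q r : ℕ) → boxSum (A ⊖ B) p q r ≡ boxSum A p q r - boxSum B p q r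
boxSum-⊖ = boxSum-∙ _-_ prefixSum--

_⊗_⊗_ : (Fin n → ℤ) → (Fin n → ℤ) → (Fin n → ℤ) → Hyper n
(f ⊗ g ⊗ h) a b c = f a * g b * h c

boxSum-⊗ : (f g h : Fin n → ℤ) (p q r : ℕ) →
           boxSum (f ⊗ g ⊗ h) p q r ≡ prefixSum p f * prefixSum q g * prefixSum r h
boxSum-⊗ f g h p q r = begin
  prefixSum p (λ a → prefixSum q λ b → prefixSum r λ c → f a * g b * h c)
    ≡⟨ prefixSum-cong p (λ a → prefixSum-cong q λ b → prefixSum-*ˡ r (f a * g b) h) ⟩
  prefixSum p (λ a → prefixSum q λ b → f a * g b * prefixSum r h)
    ≡⟨ prefixSum-cong p (λ a → prefixSum-*ʳ q (λ b → f a * g b) (prefixSum r h)) ⟩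
  prefixSum p (λ a → prefixSum q (λ b → f a * g b) * prefixSum r h)
    ≡⟨ prefixSum-cong p (λ a → cong (_* prefixSum r h) (prefixSum-*ˡ q (f a) g)) ⟩
  prefixSum p (λ a → f a * prefixSum q g * prefixSum r h)
    ≡⟨ prefixSum-*ʳ p (λ a → f a * prefixSum q g) (prefixSum r h) ⟩
  prefixSum p (λ a → f a * prefixSum q g) * prefixSum r h
    ≡⟨ cong (_* prefixSum r h) (prefixSum-*ʳ p f (prefixSum q g)) ⟩
  prefixSum p f * prefixSum q g * prefixSum r h
    ∎
  where open ≡-Reasoning

-- Dipoles and positive T-blocks

dipole : Fin n → Fin n → Fin n → ℤ
dipole p q x = δ p x - δ q x

module _ {p q : Fin n} where

  dipole-first : p ≢ q → dipole p q p ≡ 1ℤ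
  dipole-first p≢q = cong₂ _-_ (δ-diag p) (δ-≢ (p≢q ∘ sym))

  dipole-second : p ≢ q → dipole p q q ≡ -1ℤ
  dipole-second p≢q = cong₂ _-_ (δ-≢ p≢q) (δ-diag q)

  dipole-outside : {x : Fin n} → ¬ (x ≡ p ⊎ x ≡ q) → dipole p q x ≡ 0ℤ
  dipole-outside x∉ = cong₂ _-_ (δ-≢ (x∉ ∘ inj₁ ∘ sym)) (δ-≢ (x∉ ∘ inj₂ ∘ sym))

  prefixSum-dipole-nonneg : (m : ℕ) → p Fin.< q → 0ℤ ≤ prefixSum m (dipole p q)
  prefixSum-dipole-nonneg m p<q = subst (0ℤ ≤_) (sym prefixSum-dipole) indicator-antitone
    where
    prefixSum-dipole : prefixSum m (dipole p q) ≡ restrict m (λ _ → 1ℤ) p - restrict m (λ _ → 1ℤ) q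
    prefixSum-dipole = trans (prefixSum-- m (δ p) (δ q)) (cong₂ _-_ (prefixSum-δ m p) (prefixSum-δ m q))
    indicator-antitone : 0ℤ ≤ (if ⌊ toℕ p <? m ⌋ then 1ℤ else 0ℤ) - (if ⌊ toℕ q <? m ⌋ then 1ℤ else 0ℤ)
    indicator-antitone with toℕ p <? m | toℕ q <? m
    ... | yes _ | yes _ = +≤+ z≤n
    ... | yes _ | no _ = +≤+ z≤n
    ... | no _ | no _ = +≤+ z≤n
    ... | no p≮m | yes q<m = contradiction (ℕ.<-trans p<q q<m) p≮m

module _ {T : Hyper n} (T-block : IsPosTBlock T) where
  open IsPosTBlock T-block

  private
    di = dipole i₁ i₂
    dj = dipole j₁ j₂
    dk = dipole k₁ k₂
    i₁≢i₂ = Fin.<⇒≢ i₁<i₂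
    j₁≢j₂ = Fin.<⇒≢ j₁<j₂
    k₁≢k₂ = Fin.<⇒≢ k₁<k₂

  posTBlock-layer : ∀ a b → T a b k₁ ≡ di a * dj b
  posTBlock-layer a b with a ≟ i₁ ⊎-dec a ≟ i₂ | b ≟ j₁ ⊎-dec b ≟ j₂
  ... | no a∉ | _ =
    trans (zeroOutside a b k₁ (λ (a∈ , _) → a∉ a∈)) (sym (cong (_* dj b) (dipole-outside a∉)))
  ... | yes _ | no b∉ =
    trans (zeroOutside a b k₁ (λ (_ , b∈ , _) → b∉ b∈))
          (sym (trans (cong (di a *_) (dipole-outside b∉)) (ℤ.*-zeroʳ (di a))))
  ... | yes (inj₁ refl) | yes (inj₁ refl) = trans e₁ (sym (cong₂ _*_ (dipole-first i₁≢i₂) (dipole-first j₁≢j₂)))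
  ... | yes (inj₁ refl) | yes (inj₂ refl) = trans e₃ (sym (cong₂ _*_ (dipole-first i₁≢i₂) (dipole-second j₁≢j₂)))
  ... | yes (inj₂ refl) | yes (inj₁ refl) = trans e₄ (sym (cong₂ _*_ (dipole-second i₁≢i₂) (dipole-first j₁≢j₂)))
  ... | yes (inj₂ refl) | yes (inj₂ refl) = trans e₂ (sym (cong₂ _*_ (dipole-second i₁≢i₂) (dipole-second j₁≢j₂)))

  posTBlock≗dipoles : ∀ a b c → T a b c ≡ (di ⊗ dj ⊗ dk) a b c
  posTBlock≗dipoles a b c with c ≟ k₁ ⊎-dec c ≟ k₂
  ... | yes (inj₁ refl) = begin
    T a b k₁                ≡⟨ posTBlock-layer a b ⟩
    di a * dj b             ≡⟨ ℤ.*-identityʳ _ ⟨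
    di a * dj b * 1ℤ        ≡⟨ cong (di a * dj b *_) (dipole-first k₁≢k₂) ⟨
    di a * dj b * dk k₁     ∎
    where open ≡-Reasoning
  ... | yes (inj₂ refl) = begin
    T a b k₂                ≡⟨ flip a b ⟩
    - T a b k₁              ≡⟨ cong -_ (posTBlock-layer a b) ⟩
    - (di a * dj b)         ≡⟨ ℤ.-1*i≡-i _ ⟨
    -1ℤ * (di a * dj b)     ≡⟨ ℤ.*-comm -1ℤ _ ⟩
    di a * dj b * -1ℤ       ≡⟨ cong (di a * dj b *_) (dipole-second k₁≢k₂) ⟨
    di a * dj b * dk k₂     ∎
    where open ≡-Reasoning
  ... | no c∉ =
    trans (zeroOutside a b c (λ (_ , _ , c∈) → c∉ c∈))
          (sym (trans (cong (di a * dj b *_) (dipole-outside c∉)) (ℤ.*-zeroʳ (di a * dj b))))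

module _ {i₁ i₂ j₁ j₂ k₁ k₂ : Fin n} where

  private
    di = dipole i₁ i₂
    dj = dipole j₁ j₂
    dk = dipole k₁ k₂

  dipoles-isPosTBlock : i₁ Fin.< i₂ → j₁ Fin.< j₂ → k₁ Fin.< k₂ → IsPosTBlock (di ⊗ dj ⊗ dk)
  dipoles-isPosTBlock i₁<i₂ j₁<j₂ k₁<k₂ = record
    { i₁ = i₁ ; i₂ = i₂ ; j₁ = j₁ ; j₂ = j₂ ; k₁ = k₁ ; k₂ = k₂
    ; i₁<i₂ = i₁<i₂ ; j₁<j₂ = j₁<j₂ ; k₁<k₂ = k₁<k₂
    ; zeroOutside = vanishes
    ; e₁ = corner (dipole-first i₁≢i₂) (dipole-first j₁≢j₂)
    ; e₂ = corner (dipole-second i₁≢i₂) (dipole-second j₁≢j₂)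
    ; e₃ = corner (dipole-first i₁≢i₂) (dipole-second j₁≢j₂)
    ; e₄ = corner (dipole-second i₁≢i₂) (dipole-first j₁≢j₂)
    ; flip = λ a b → begin
        di a * dj b * dk k₂      ≡⟨ cong (di a * dj b *_) (dipole-second k₁≢k₂) ⟩
        di a * dj b * -1ℤ        ≡⟨ negate (di a * dj b) ⟩
        - (di a * dj b * 1ℤ)     ≡⟨ cong (λ t → - (di a * dj b * t)) (dipole-first k₁≢k₂) ⟨
        - (di a * dj b * dk k₁)  ∎
    }
    where
    open ≡-Reasoning
    i₁≢i₂ = Fin.<⇒≢ i₁<i₂
    j₁≢j₂ = Fin.<⇒≢ j₁<j₂
    k₁≢k₂ = Fin.<⇒≢ k₁<k₂

    corner : ∀ {a b u v} → di a ≡ u → dj b ≡ v → di a * dj b * dk k₁ ≡ u * v * 1ℤ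
    corner {u = u} {v} da≡u db≡v =
      trans (cong₂ (λ s t → s * t * dk k₁) da≡u db≡v) (cong (u * v *_) (dipole-first k₁≢k₂))

    negate : ∀ x → x * -1ℤ ≡ - (x * 1ℤ)
    negate = solve-∀

    vanishes : ∀ a b c → ¬ ((a ≡ i₁ ⊎ a ≡ i₂) × (b ≡ j₁ ⊎ b ≡ j₂) × (c ≡ k₁ ⊎ c ≡ k₂)) →
               di a * dj b * dk c ≡ 0ℤ
    vanishes a b c out with a ≟ i₁ ⊎-dec a ≟ i₂ | b ≟ j₁ ⊎-dec b ≟ j₂ | c ≟ k₁ ⊎-dec c ≟ k₂
    ... | yes a∈ | yes b∈ | yes c∈ = ⊥-elim (out (a∈ , b∈ , c∈))
    ... | no a∉ | _ | _ = cong (λ t → t * dj b * dk c) (dipole-outside a∉)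
    ... | yes _ | no b∉ | _ =
      trans (cong (λ t → di a * t * dk c) (dipole-outside b∉)) (cong (_* dk c) (ℤ.*-zeroʳ (di a)))
    ... | yes _ | yes _ | no c∉ = trans (cong (di a * dj b *_) (dipole-outside c∉)) (ℤ.*-zeroʳ (di a * dj b))

*-nonneg : {i j : ℤ} → 0ℤ ≤ i → 0ℤ ≤ j → 0ℤ ≤ i * j
*-nonneg {+ m} {+ n} _ _ = subst (0ℤ ≤_) (ℤ.pos-* m n) (+≤+ z≤n)

posTBlock-boxSum-nonneg : {T : Hyper n} → IsPosTBlock T → (p q r : ℕ) → 0ℤ ≤ boxSum T p q r
posTBlock-boxSum-nonneg T-block p q r = subst (0ℤ ≤_) (sym boxSum-T)
  (*-nonneg (*-nonneg (prefixSum-dipole-nonneg p i₁<i₂) (prefixSum-dipole-nonneg q j₁<j₂))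
            (prefixSum-dipole-nonneg r k₁<k₂))
  where
  open IsPosTBlock T-block
  boxSum-T : boxSum _ p q r ≡ prefixSum p (dipole i₁ i₂) * prefixSum q (dipole j₁ j₂) * prefixSum r (dipole k₁ k₂)
  boxSum-T = trans (boxSum-cong (posTBlock≗dipoles T-block) p q r) (boxSum-⊗ _ _ _ p q r)

-- Sums of positive T-blocks

-- A ⪯B B is, by definition, IsTBlockSum (A ⊖ B).
IsTBlockSum : Hyper n → Set
IsTBlockSum {n} D = Σ (List (Hyper n)) λ Ts → All IsPosTBlock Ts × (∀ i j k → D i j k ≡ sumH Ts i j k)

tBlockSum⇒Ξ-nonneg : {D : Hyper n} → IsTBlockSum D → ∀ i j k → 0ℤ ≤ Ξ D i j k
tBlockSum⇒Ξ-nonneg {D = D} (Ts , blocks , D≗Ts) i j k =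
  subst (0ℤ ≤_) (sym (trans (Ξ≡boxSum D i j k) (boxSum-cong D≗Ts p q r))) (sumH-nonneg Ts blocks)
  where
  p = toℕ i
  q = toℕ j
  r = toℕ k
  sumH-nonneg : ∀ Ts → All IsPosTBlock Ts → 0ℤ ≤ boxSum (sumH Ts) p q r
  sumH-nonneg [] [] = subst (0ℤ ≤_) (sym (boxSum-zeroH p q r)) ℤ.≤-refl
  sumH-nonneg (T ∷ Ts) (T-block ∷ blocks) = subst (0ℤ ≤_) (sym (boxSum-⊕ T (sumH Ts) p q r))
    (ℤ.+-mono-≤ (posTBlock-boxSum-nonneg T-block p q r) (sumH-nonneg Ts blocks))

sumH-++ : (Ts Us : List (Hyper n)) → ∀ i j k → sumH (Ts ++ Us) i j k ≡ sumH Ts i j k + sumH Us i j k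
sumH-++ [] Us i j k = sym (ℤ.+-identityˡ _)
sumH-++ (T ∷ Ts) Us i j k = trans (cong (_+_ (T i j k)) (sumH-++ Ts Us i j k)) (sym (ℤ.+-assoc (T i j k) _ _))

sumH-replicate : (l : ℕ) (T : Hyper n) → ∀ i j k → sumH (replicate l T) i j k ≡ + l * T i j k
sumH-replicate zero T i j k = refl
sumH-replicate (suc l) T i j k =
  trans (cong (_+_ (T i j k)) (sumH-replicate l T i j k)) (sym (ℤ.suc-* (+ l) (T i j k)))

_·_ : ℤ → Hyper n → Hyper n
(κ · T) i j k = κ * T i j k

∑ᴴ : (Fin m → Hyper n) → Hyper n
∑ᴴ {m} F i j k = ∑[ a < m ] F a i j k

tBlockSum-cong : {D E : Hyper n} → (∀ i j k → D i j k ≡ E i j k) → IsTBlockSum D → IsTBlockSum E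
tBlockSum-cong D≗E (Ts , blocks , D≗Ts) = Ts , blocks , λ i j k → trans (sym (D≗E i j k)) (D≗Ts i j k)

tBlockSum-⊕ : {D E : Hyper n} → IsTBlockSum D → IsTBlockSum E → IsTBlockSum (D ⊕ E)
tBlockSum-⊕ (Ts , Ts-blocks , D≗Ts) (Us , Us-blocks , E≗Us) =
  Ts ++ Us , All.++⁺ Ts-blocks Us-blocks ,
  λ i j k → trans (cong₂ _+_ (D≗Ts i j k) (E≗Us i j k)) (sym (sumH-++ Ts Us i j k))

tBlockSum-· : {κ : ℤ} {T : Hyper n} → 0ℤ ≤ κ → IsPosTBlock T → IsTBlockSum (κ · T)
tBlockSum-· {κ = κ} {T} 0≤κ T-block = replicate copies T , All.replicate⁺ copies T-block ,
  λ i j k → trans (cong (_* T i j k) (sym (ℤ.0≤i⇒+∣i∣≡i 0≤κ))) (sym (sumH-replicate copies T i j k))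
  where copies = ∣ κ ∣

tBlockSum-∑ᴴ : {F : Fin m → Hyper n} → (∀ a → IsTBlockSum (F a)) → IsTBlockSum (∑ᴴ F)
tBlockSum-∑ᴴ {zero} _ = [] , [] , λ _ _ _ → refl
tBlockSum-∑ᴴ {suc m} F-sums = tBlockSum-⊕ (F-sums zero) (tBlockSum-∑ᴴ (F-sums ∘ suc))

-- Zero line sums and the block decomposition

record HasZeroLineSums (D : Hyper n) : Set where
  field
    line₁ : ∀ j k → ∑[ i < n ] D i j k ≡ 0ℤ
    line₂ : ∀ i k → ∑[ j < n ] D i j k ≡ 0ℤ
    line₃ : ∀ i j → ∑[ k < n ] D i j k ≡ 0ℤ

foldr-filter-nonzero : (xs : List ℤ) → foldr _+_ 0ℤ (filterᵇ isNonzero xs) ≡ foldr _+_ 0ℤ xs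
foldr-filter-nonzero [] = refl
foldr-filter-nonzero (+ zero ∷ xs) = trans (foldr-filter-nonzero xs) (sym (ℤ.+-identityˡ _))
foldr-filter-nonzero (x@(+ suc _) ∷ xs) = cong (_+_ x) (foldr-filter-nonzero xs)
foldr-filter-nonzero (x@(ℤ.-[1+ _ ]) ∷ xs) = cong (_+_ x) (foldr-filter-nonzero xs)

altSeq-sum : {xs : List ℤ} → AltSeq xs → foldr _+_ 0ℤ xs ≡ 1ℤ
altSeq-sum single = refl
altSeq-sum (step {xs} s) =
  trans (sym (ℤ.+-assoc 1ℤ -1ℤ (foldr _+_ 0ℤ xs))) (trans (ℤ.+-identityˡ _) (altSeq-sum s))

altLine-sum : (f : Fin n → ℤ) → AltLine (toList f) → sum f ≡ 1ℤ
altLine-sum f alt =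
  trans (sym (sum-toList f)) (trans (sym (foldr-filter-nonzero (toList f))) (altSeq-sum alt))

ashm-⊖-zeroLineSums : {A B : Hyper n} → IsASHM A → IsASHM B → HasZeroLineSums (A ⊖ B)
ashm-⊖-zeroLineSums {A = A} {B} A-ashm B-ashm = record
  { line₁ = λ j k → lines-cancel (λ i → A i j k) (λ i → B i j k) (A.line₁ j k) (B.line₁ j k)
  ; line₂ = λ i k → lines-cancel (λ j → A i j k) (λ j → B i j k) (A.line₂ i k) (B.line₂ i k)
  ; line₃ = λ i j → lines-cancel (λ k → A i j k) (λ k → B i j k) (A.line₃ i j) (B.line₃ i j)
  }
  where
  module A = IsASHM A-ashm
  module B = IsASHM B-ashm
  lines-cancel : (f g : Fin _ → ℤ) → AltLine (toList f) → AltLine (toList g) →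
                 ∑[ a < _ ] (f a - g a) ≡ 0ℤ
  lines-cancel f g f-alt g-alt =
    trans (∑-distrib-- f g) (cong₂ _-_ (altLine-sum f f-alt) (altLine-sum g g-alt))

adjacentDipole : Fin n → Fin (suc n) → ℤ
adjacentDipole a = dipole (inject₁ a) (suc a)

∑-δ-inject₁ : (h : ℕ → ℤ) → h (suc n) ≡ 0ℤ → (x : Fin (suc n)) →
              ∑[ a < n ] (h (suc (toℕ a)) * δ (inject₁ a) x) ≡ h (suc (toℕ x))
∑-δ-inject₁ {n} h h[1+n]≡0 x = begin
  ∑[ a < n ] (h (suc (toℕ a)) * δ (inject₁ a) x)
    ≡⟨ sum-cong-≗ (λ a → cong (λ t → h (suc t) * δ (inject₁ a) x) (Fin.toℕ-inject₁ a)) ⟨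
  ∑[ a < n ] g (inject₁ a)
    ≡⟨ ℤ.+-identityʳ _ ⟨
  ∑[ a < n ] g (inject₁ a) + 0ℤ
    ≡⟨ cong (_+_ (∑[ a < n ] g (inject₁ a))) g-last ⟨
  ∑[ a < n ] g (inject₁ a) + g (fromℕ n)
    ≡⟨ sum-init-last g ⟨
  sum g
    ≡⟨ ∑-δ (h ∘ suc ∘ toℕ) x ⟩
  h (suc (toℕ x))
    ∎
  where
  open ≡-Reasoning
  g : Fin (suc n) → ℤ
  g b = h (suc (toℕ b)) * δ b x
  g-last : g (fromℕ n) ≡ 0ℤ
  g-last = cong (_* δ (fromℕ n) x) (trans (cong (h ∘ suc) (Fin.toℕ-fromℕ n)) h[1+n]≡0)

∑-δ-suc : (h : ℕ → ℤ) → h 0 ≡ 0ℤ → (x : Fin (suc n)) →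
          ∑[ a < n ] (h (suc (toℕ a)) * δ (suc a) x) ≡ h (toℕ x)
∑-δ-suc {n} h h0≡0 zero = begin
  ∑[ a < n ] (h (suc (toℕ a)) * 0ℤ)  ≡⟨ sum-cong-≗ (λ (a : Fin n) → ℤ.*-zeroʳ (h (suc (toℕ a)))) ⟩
  ∑[ a < n ] 0ℤ                      ≡⟨ sum-replicate-zero n ⟩
  0ℤ                                 ≡⟨ h0≡0 ⟨
  h 0                                ∎
  where open ≡-Reasoning
∑-δ-suc h _ (suc x) = ∑-δ (h ∘ suc ∘ toℕ) x

∑-by-parts : (h : ℕ → ℤ) → h 0 ≡ 0ℤ → h (suc n) ≡ 0ℤ → (x : Fin (suc n)) →
             ∑[ a < n ] (h (suc (toℕ a)) * adjacentDipole a x) ≡ h (suc (toℕ x)) - h (toℕ x)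
∑-by-parts {n} h h0≡0 h[1+n]≡0 x = begin
  ∑[ a < n ] (h (suc (toℕ a)) * adjacentDipole a x)
    ≡⟨ sum-cong-≗ (λ a → distrib (h (suc (toℕ a))) (δ (inject₁ a) x) (δ (suc a) x)) ⟩
  ∑[ a < n ] (h (suc (toℕ a)) * δ (inject₁ a) x - h (suc (toℕ a)) * δ (suc a) x)
    ≡⟨ ∑-distrib-- (λ a → h (suc (toℕ a)) * δ (inject₁ a) x) (λ a → h (suc (toℕ a)) * δ (suc a) x) ⟩
  ∑[ a < n ] (h (suc (toℕ a)) * δ (inject₁ a) x) - ∑[ a < n ] (h (suc (toℕ a)) * δ (suc a) x)
    ≡⟨ cong₂ _-_ (∑-δ-inject₁ h h[1+n]≡0 x) (∑-δ-suc h h0≡0 x) ⟩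
  h (suc (toℕ x)) - h (toℕ x)
    ∎
  where
  open ≡-Reasoning
  distrib : ∀ k u v → k * (u - v) ≡ k * u - k * v
  distrib = solve-∀

prefixSum-inversion : (G : Fin (suc n) → ℤ) → sum G ≡ 0ℤ → (x : Fin (suc n)) →
                      G x ≡ ∑[ a < n ] (prefixSum (suc (toℕ a)) G * adjacentDipole a x)
prefixSum-inversion {n} G ∑G≡0 x = sym (begin
  ∑[ a < n ] (prefixSum (suc (toℕ a)) G * adjacentDipole a x)
    ≡⟨ ∑-by-parts (λ m → prefixSum m G) (prefixSum-0 G) (trans (prefixSum-full G) ∑G≡0) x ⟩
  prefixSum (suc (toℕ x)) G - prefixSum (toℕ x) G
    ≡⟨ cong (_- prefixSum (toℕ x) G) (prefixSum-suc x G) ⟩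
  prefixSum (toℕ x) G + G x - prefixSum (toℕ x) G
    ≡⟨ cancel (prefixSum (toℕ x) G) (G x) ⟩
  G x
    ∎)
  where
  open ≡-Reasoning
  cancel : ∀ u v → u + v - u ≡ v
  cancel = solve-∀

adjacentBlock : Fin n → Fin n → Fin n → Hyper (suc n)
adjacentBlock a b c = adjacentDipole a ⊗ adjacentDipole b ⊗ adjacentDipole c

blockDecomposition : Hyper (suc n) → Hyper (suc n)
blockDecomposition D = ∑ᴴ λ c → ∑ᴴ λ b → ∑ᴴ λ a →
  boxSum D (suc (toℕ a)) (suc (toℕ b)) (suc (toℕ c)) · adjacentBlock a b c

zeroLineSums⇒≗blockDecomposition : {D : Hyper (suc n)} → HasZeroLineSums D →
                                    ∀ x y z → D x y z ≡ blockDecomposition D x y z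
zeroLineSums⇒≗blockDecomposition {n} {D} zero-lines x y z = begin
  D x y z
    ≡⟨ prefixSum-inversion (D x y) (line₃ x y) z ⟩
  ∑[ c < n ] (P c (D x y) * e c z)
    ≡⟨ sum-cong-≗ (λ c → cong (_* e c z) (slice c)) ⟩
  ∑[ c < n ] (∑[ b < n ] (∑[ a < n ] (κ a b c * e a x) * e b y) * e c z)
    ≡⟨ sum-cong-≗ (λ c → distribute (λ b a → κ a b c * e a x) (λ b → e b y) (e c z)) ⟩
  ∑[ c < n ] ∑[ b < n ] ∑[ a < n ] (κ a b c * e a x * e b y * e c z)
    ≡⟨ sum-cong-≗ (λ c → sum-cong-≗ λ b → sum-cong-≗ λ a →
         reassociate (κ a b c) (e a x) (e b y) (e c z)) ⟩
  blockDecomposition D x y z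
    ∎
  where
  open ≡-Reasoning
  open HasZeroLineSums zero-lines
  P : Fin n → (Fin (suc n) → ℤ) → ℤ
  P c = prefixSum (suc (toℕ c))
  e = adjacentDipole
  κ : Fin n → Fin n → Fin n → ℤ
  κ a b c = boxSum D (suc (toℕ a)) (suc (toℕ b)) (suc (toℕ c))

  slice : ∀ c → P c (D x y) ≡ ∑[ b < n ] (∑[ a < n ] (κ a b c * e a x) * e b y)
  slice c = begin
    P c (D x y)
      ≡⟨ prefixSum-inversion (λ y′ → P c (D x y′)) (∑-prefixSum-zero _ (D x) (line₂ x)) y ⟩
    ∑[ b < n ] (P b (λ y′ → P c (D x y′)) * e b y)
      ≡⟨ sum-cong-≗ (λ b →
           cong (_* e b y) (prefixSum-inversion (λ x′ → P b (λ y′ → P c (D x′ y′))) (lines b) x)) ⟩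
    ∑[ b < n ] (∑[ a < n ] (κ a b c * e a x) * e b y)
      ∎
    where
    lines : ∀ b → ∑[ x′ < suc n ] P b (λ y′ → P c (D x′ y′)) ≡ 0ℤ
    lines b = ∑-prefixSum-zero _ (λ x′ y′ → P c (D x′ y′)) λ y′ →
              ∑-prefixSum-zero _ (λ x′ → D x′ y′) (line₁ y′)

  distribute : (f : Fin n → Fin n → ℤ) (g : Fin n → ℤ) (k : ℤ) →
               ∑[ b < n ] (sum (f b) * g b) * k ≡ ∑[ b < n ] ∑[ a < n ] (f b a * g b * k)
  distribute f g k = begin
    ∑[ b < n ] (sum (f b) * g b) * k
      ≡⟨ *-distribʳ-sum k (λ b → sum (f b) * g b) ⟩
    ∑[ b < n ] (sum (f b) * g b * k)
      ≡⟨ sum-cong-≗ (λ b → cong (_* k) (*-distribʳ-sum (g b) (f b))) ⟩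
    ∑[ b < n ] (∑[ a < n ] (f b a * g b) * k)
      ≡⟨ sum-cong-≗ (λ b → *-distribʳ-sum k (λ a → f b a * g b)) ⟩
    ∑[ b < n ] ∑[ a < n ] (f b a * g b * k)
      ∎

  reassociate : ∀ u v w t → u * v * w * t ≡ u * (v * w * t)
  reassociate = solve-∀

adjacentBlock-isPosTBlock : (a b c : Fin n) → IsPosTBlock (adjacentBlock a b c)
adjacentBlock-isPosTBlock a b c = dipoles-isPosTBlock (inject₁<suc a) (inject₁<suc b) (inject₁<suc c)
  where
  inject₁<suc : (a : Fin n) → inject₁ a Fin.< suc a
  inject₁<suc a = Fin.≤̄⇒inject₁< ℕ.≤-refl

zeroLineSums⇒tBlockSum : {D : Hyper n} → HasZeroLineSums D → (∀ i j k → 0ℤ ≤ Ξ D i j k) →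
                         IsTBlockSum D
zeroLineSums⇒tBlockSum {zero} _ _ = [] , [] , λ ()
zeroLineSums⇒tBlockSum {suc n} {D} zero-lines Ξ-nonneg =
  tBlockSum-cong (λ x y z → sym (zeroLineSums⇒≗blockDecomposition zero-lines x y z))
    (tBlockSum-∑ᴴ λ c → tBlockSum-∑ᴴ λ b → tBlockSum-∑ᴴ λ a →
      tBlockSum-· (coefficient-nonneg a b c) (adjacentBlock-isPosTBlock a b c))
  where
  coefficient-nonneg : (a b c : Fin n) → 0ℤ ≤ boxSum D (suc (toℕ a)) (suc (toℕ b)) (suc (toℕ c))
  coefficient-nonneg a b c
    rewrite sym (Fin.toℕ-inject₁ a) | sym (Fin.toℕ-inject₁ b) | sym (Fin.toℕ-inject₁ c)
    = subst (0ℤ ≤_) (Ξ≡boxSum D _ _ _) (Ξ-nonneg (suc (inject₁ a)) (suc (inject₁ b)) (suc (inject₁ c)))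

Ξ-⊖ : (A B : Hyper n) → ∀ i j k → Ξ (A ⊖ B) i j k ≡ Ξ A i j k - Ξ B i j k
Ξ-⊖ A B i j k = begin
  Ξ (A ⊖ B) i j k                        ≡⟨ Ξ≡boxSum (A ⊖ B) i j k ⟩
  boxSum (A ⊖ B) (toℕ i) (toℕ j) (toℕ k)  ≡⟨ boxSum-⊖ A B (toℕ i) (toℕ j) (toℕ k) ⟩
  boxSum A (toℕ i) (toℕ j) (toℕ k) - boxSum B (toℕ i) (toℕ j) (toℕ k)
                                         ≡⟨ cong₂ _-_ (Ξ≡boxSum A i j k) (Ξ≡boxSum B i j k) ⟨
  Ξ A i j k - Ξ B i j k                  ∎
  where open ≡-Reasoning

Ξ≥⇔Ξ-⊖-nonneg : {A B : Hyper n} → A Ξ≥ B ⇔ (∀ i j k → 0ℤ ≤ Ξ (A ⊖ B) i j k)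
Ξ≥⇔Ξ-⊖-nonneg {A = A} {B} = mk⇔
  (λ A≥B i j k → subst (0ℤ ≤_) (sym (Ξ-⊖ A B i j k)) (ℤ.i≤j⇒0≤j-i (A≥B i j k)))
  (λ Ξ-nonneg i j k → ℤ.0≤i-j⇒j≤i (subst (0ℤ ≤_) (Ξ-⊖ A B i j k) (Ξ-nonneg i j k)))

mainTheorem10 : (n : ℕ) (A B : Hyper n) → IsASHM A → IsASHM B →
    (A ⪯B B → A Ξ≥ B) × (A Ξ≥ B → A ⪯B B)
mainTheorem10 n A B A-ashm B-ashm =
    (λ A⪯B → from (tBlockSum⇒Ξ-nonneg A⪯B))
  , (λ A≥B → zeroLineSums⇒tBlockSum (ashm-⊖-zeroLineSums A-ashm B-ashm) (to A≥B))
  where open Equivalence (Ξ≥⇔Ξ-⊖-nonneg {A = A} {B})
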